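{- Let $G$ be the graph with the 23 vertices $w_1,a_1,a_2,a_3,b_1,b_2,b_3,b_4,c_1,c_2,c_3,c_4,c_5,d_1,d_2,d_3,e_1,e_2,e_3,f_1,f_2,f_3,w_2$ and the following 60 edges: $w_1a_1, w_1a_2, w_1a_3$; $a_1a_2, a_2a_3, a_1b_1, a_1b_2, a_1b_3, a_2b_2, a_2b_3, a_2b_4, a_3b_3, a_3b_4$; $b_1b_2, b_2b_3, b_3b_4, b_1c_1, b_1c_2, b_1c_3, b_2c_2, b_2c_3, b_2c_4, b_3c_3, b_3c_4, b_3c_5, b_4c_4, b_4c_5$; $c_1c_2, c_2c_3, c_3c_4, c_4c_5, c_1d_1, c_1d_2, c_1d_3, c_2d_2, c_2d_3, c_3d_3$; $d_1d_2, d_2d_3, d_1e_1, d_1e_2, d_2e_1, d_2e_2, d_2e_3, d_3e_2, d_3e_3, d_1w_2$; $e_1e_2, e_2e_3, e_1f_1, e_1f_2, e_2f_1, e_2f_2, e_2f_3, e_3f_2, e_3f_3, e_1w_2$; $f_1f_2, f_2f_3, f_1w_2$. Then $\tau_s(G)>2$, i.e., there is no graph $H$ having $G$ as a spanning subgraph with $\beta_s(H)=2$.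
   Context: For vertices $u,v,w$ of a connected graph, $w$ strongly resolves $u,v$ if there is a shortest $u$-$w$ path containing $v$ or a shortest $v$-$w$ path containing $u$. A strong resolving set is a set $W$ such that every pair of vertices is strongly resolved by some vertex of $W$; the strong dimension $\beta_s(H)$ is the minimum size of a strong resolving set of $H$. The threshold strong dimension $\tau_s(G)$ is the minimum of $\beta_s(H)$ over all graphs $H$ having $G$ as a spanning subgraph. -}

module Defs where

open import Data.Nat using (ℕ; zero; suc; _≤_; _<_)
open import Data.Bool using (Bool; true; false)
open import Data.Fin using (Fin; #_)
open import Data.Fin.Subset using (Subset; _∈_; ∣_∣)
open import Data.List using (List; []; _∷_)
open import Data.List.Relation.Unary.Unique.Propositional using (Unique)
open import Data.Product using (Σ; _×_; _,_)
open import Data.Sum using (_⊎_)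
open import Relation.Binary.PropositionalEquality using (_≡_; _≢_)
import Data.List.Membership.Propositional as LM

record Graph (n : ℕ) : Set where
  field
    adj    : Fin n → Fin n → Bool
    sym    : ∀ x y → adj x y ≡ adj y x
    irrefl : ∀ x → adj x x ≡ false
open Graph public

module _ {n : ℕ} (H : Graph n) where

  data Walk : Fin n → Fin n → Set where
    here : ∀ {u} → Walk u u
    step : ∀ {u v w} → adj H u v ≡ true → Walk v w → Walk u w

  len : ∀ {u w} → Walk u w → ℕ
  len here       = 0
  len (step _ p) = suc (len p)

  verts : ∀ {u w} → Walk u w → List (Fin n)
  verts {u} here       = u ∷ []
  verts {u} (step _ p) = u ∷ verts p

  IsPath : ∀ {u w} → Walk u w → Set
  IsPath p = Unique (verts p)

  IsShortestPath : ∀ {u w} → Walk u w → Set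
  IsShortestPath {u} {w} p = IsPath p × (∀ (q : Walk u w) → IsPath q → len p ≤ len q)

  _onWalk_ : ∀ {u w} → Fin n → Walk u w → Set
  v onWalk p = v LM.∈ verts p

  StronglyResolves : Fin n → Fin n → Fin n → Set
  StronglyResolves w u v =
    (Σ (Walk u w) λ p → IsShortestPath p × v onWalk p)
    ⊎ (Σ (Walk v w) λ p → IsShortestPath p × u onWalk p)

  IsStrongResolvingSet : Subset n → Set
  IsStrongResolvingSet W =
    ∀ u v → u ≢ v → Σ (Fin n) λ w → w ∈ W × StronglyResolves w u v

w₁ a₁ a₂ a₃ b₁ b₂ b₃ b₄ c₁ c₂ c₃ c₄ c₅ d₁ d₂ d₃ e₁ e₂ e₃ f₁ f₂ f₃ w₂ : Fin 23
w₁ = # 0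
a₁ = # 1
a₂ = # 2
a₃ = # 3
b₁ = # 4
b₂ = # 5
b₃ = # 6
b₄ = # 7
c₁ = # 8
c₂ = # 9
c₃ = # 10
c₄ = # 11
c₅ = # 12
d₁ = # 13
d₂ = # 14
d₃ = # 15
e₁ = # 16
e₂ = # 17
e₃ = # 18
f₁ = # 19
f₂ = # 20
f₃ = # 21
w₂ = # 22

edgesG : List (Fin 23 × Fin 23)
edgesG =
  (w₁ , a₁) ∷ (w₁ , a₂) ∷ (w₁ , a₃) ∷
  (a₁ , a₂) ∷ (a₂ , a₃) ∷ (a₁ , b₁) ∷ (a₁ , b₂) ∷ (a₁ , b₃) ∷ (a₂ , b₂) ∷ (a₂ , b₃) ∷ (a₂ , b₄) ∷ (a₃ , b₃) ∷ (a₃ , b₄) ∷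
  (b₁ , b₂) ∷ (b₂ , b₃) ∷ (b₃ , b₄) ∷ (b₁ , c₁) ∷ (b₁ , c₂) ∷ (b₁ , c₃) ∷ (b₂ , c₂) ∷ (b₂ , c₃) ∷ (b₂ , c₄) ∷ (b₃ , c₃) ∷ (b₃ , c₄) ∷ (b₃ , c₅) ∷ (b₄ , c₄) ∷ (b₄ , c₅) ∷
  (c₁ , c₂) ∷ (c₂ , c₃) ∷ (c₃ , c₄) ∷ (c₄ , c₅) ∷ (c₁ , d₁) ∷ (c₁ , d₂) ∷ (c₁ , d₃) ∷ (c₂ , d₂) ∷ (c₂ , d₃) ∷ (c₃ , d₃) ∷
  (d₁ , d₂) ∷ (d₂ , d₃) ∷ (d₁ , e₁) ∷ (d₁ , e₂) ∷ (d₂ , e₁) ∷ (d₂ , e₂) ∷ (d₂ , e₃) ∷ (d₃ , e₂) ∷ (d₃ , e₃) ∷ (d₁ , w₂) ∷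
  (e₁ , e₂) ∷ (e₂ , e₃) ∷ (e₁ , f₁) ∷ (e₁ , f₂) ∷ (e₂ , f₁) ∷ (e₂ , f₂) ∷ (e₂ , f₃) ∷ (e₃ , f₂) ∷ (e₃ , f₃) ∷ (e₁ , w₂) ∷
  (f₁ , f₂) ∷ (f₂ , f₃) ∷ (f₁ , w₂) ∷ []

-- H contains every edge of G (adjacency of H is symmetric, so one orientation suffices)
ContainsG : Graph 23 → Set
ContainsG H = ∀ x y → (x , y) LM.∈ edgesG → adj H x y ≡ true

-- If {x, y} strongly resolves H, then for u ≠ v one of the landmarks t has u or v on a shortest
-- path to it, so d(u, v) = |d(u, t) − d(v, t)|.  Together with the reverse triangle inequality
-- this makes v ↦ (d(v, x), d(v, y)) an isometric embedding of H into ℕ² with the Chebyshev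
-- metric, in which only the landmarks have a zero coordinate, distances are bounded by those
-- of the spanning subgraph G, and two vertices at distance 2 have a common neighbour.  An
-- exhaustive search over such labellings, for every choice of x and y, finds none.
module Submission where

open import Defs
open import Data.Nat using (_<_)
open import Data.Fin.Subset using (Subset; ∣_∣)

open import Data.Bool using (Bool; true; T; not; _∧_)
import Data.Bool.Properties as Bool
open import Data.Bool.ListAction using (any)
open import Data.Empty using (⊥-elim)
open import Data.Fin using (Fin; zero; suc)
import Data.Fin.Properties as Fin
open import Data.Fin.Subset using (inside; outside) renaming (_∈_ to _∈ₛ_)
open import Data.List using (List; []; _∷_; map; length; upTo; allFin; concatMap; filter; cartesianProduct)
open import Data.List.Properties using (length-map)
open import Data.List.Membership.Propositional using (_∈_; find)
open import Data.List.Membership.Propositional.Properties using (∈-map⁺; ∈-upTo⁺; ∈-cartesianProduct⁺)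
open import Data.List.Relation.Unary.All as All using (All; all?)
import Data.List.Relation.Unary.All.Properties as All
open import Data.List.Relation.Unary.AllPairs using ([]; _∷_)
open import Data.List.Relation.Unary.Any as Any using (Any; any?; here; there)
import Data.List.Relation.Unary.Any.Properties as Any
open import Data.Nat using (ℕ; zero; suc; _+_; _≤_; _⊔_; ∣_-_∣; z≤n; s≤s; s≤s⁻¹; _≤?_; _<?_)
import Data.Nat.Properties as ℕ
open import Data.Nat.Properties
  using (≤-refl; ≤-reflexive; ≤-trans; ≤-antisym; m≤n⇒m≤1+n; n≤0⇒n≡0; +-mono-≤; +-comm;
         m≤m⊔n; m≤n⊔m; ⊔-lub; ≮⇒≥; ∣-∣-comm; ∣m-m+n∣≡n; ∣m-n∣≡[m∸n]∨[n∸m]; m≤n+o⇒m∸n≤o)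
open import Data.Product using (Σ; ∃; ∃₂; _×_; _,_; proj₁; proj₂)
open import Data.Sum using (_⊎_; inj₁; inj₂; [_,_]; map₂)
open import Data.Vec using (Vec; []; _∷_; lookup; here; there)
open import Function using (_∘_; Equivalence)
open import Relation.Binary.PropositionalEquality using (_≡_; _≢_; refl; trans; cong; subst)
import Relation.Binary.PropositionalEquality as ≡
open import Relation.Nullary using (¬_; Dec; yes; no; ¬?; contradiction)
open import Relation.Nullary.Decidable using (_×-dec_; _→-dec_; _⊎-dec_; map′; ⌊_⌋; True; toWitness; fromWitness; T?)
open import Relation.Unary using (Decidable)

m≤n+o∧n≤m+o⇒∣m-n∣≤o : ∀ {m n o} → m ≤ n + o → n ≤ m + o → ∣ m - n ∣ ≤ o
m≤n+o∧n≤m+o⇒∣m-n∣≤o {m} {n} m≤n+o n≤m+o with ∣m-n∣≡[m∸n]∨[n∸m] m n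
... | inj₁ eq = ≤-trans (≤-reflexive eq) (m≤n+o⇒m∸n≤o m n m≤n+o)
... | inj₂ eq = ≤-trans (≤-reflexive eq) (m≤n+o⇒m∸n≤o n m n≤m+o)

least-witness : ∀ {P : ℕ → Set} → Decidable P → ∀ {m} → P m →
                Σ ℕ λ k → P k × (∀ {j} → P j → k ≤ j)
least-witness P? {zero} p = 0 , p , λ _ → z≤n
least-witness P? {suc m} p with P? 0
... | yes p₀ = 0 , p₀ , λ _ → z≤n
... | no ¬p₀ with least-witness (P? ∘ suc) p
...   | k , pk , k-least = suc k , pk , λ { {zero} p₀ → contradiction p₀ ¬p₀ ; {suc j} pj → s≤s (k-least pj) }

module Walks {n : ℕ} (H : Graph n) where

  open import Data.List.Membership.DecPropositional (Fin._≟_ {n}) using (_∈?_)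

  infixr 5 _++ʷ_
  _++ʷ_ : ∀ {u v w} → Walk H u v → Walk H v w → Walk H u w
  here     ++ʷ q = q
  step e p ++ʷ q = step e (p ++ʷ q)

  len-++ʷ : ∀ {u v w} (p : Walk H u v) (q : Walk H v w) → len H (p ++ʷ q) ≡ len H p + len H q
  len-++ʷ here       q = refl
  len-++ʷ (step e p) q = cong suc (len-++ʷ p q)

  reverse : ∀ {u v} → Walk H u v → Walk H v u
  reverse here               = here
  reverse (step {u} {v} e p) = reverse p ++ʷ step (trans (Graph.sym H v u) e) here

  len-reverse : ∀ {u v} (p : Walk H u v) → len H (reverse p) ≡ len H p
  len-reverse here = refl
  len-reverse (step {u} {v} e p) = begin
    len H (reverse p ++ʷ step _ here)  ≡⟨ len-++ʷ (reverse p) (step _ here) ⟩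
    len H (reverse p) + 1              ≡⟨ cong (_+ 1) (len-reverse p) ⟩
    len H p + 1                        ≡⟨ +-comm (len H p) 1 ⟩
    suc (len H p)                      ∎
    where open ≡.≡-Reasoning

  split-at : ∀ {u v w} (p : Walk H u w) → v ∈ verts H p →
             Σ (Walk H u v) λ p₁ → Σ (Walk H v w) λ p₂ → len H p₁ + len H p₂ ≡ len H p
  split-at here       (here refl)  = here , here , refl
  split-at (step e p) (here refl)  = here , step e p , refl
  split-at (step e p) (there v∈p) with split-at p v∈p
  ... | p₁ , p₂ , eq = step e p₁ , p₂ , cong suc eq

  suffix-path : ∀ {u v w} (p : Walk H u w) → IsPath H p → v ∈ verts H p →
                Σ (Walk H v w) λ q → IsPath H q × len H q ≤ len H p
  suffix-path here       p-path       (here refl)  = here , p-path , ≤-refl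
  suffix-path (step e p) p-path       (here refl)  = step e p , p-path , ≤-refl
  suffix-path (step e p) (_ ∷ p-path) (there v∈p) with suffix-path p p-path v∈p
  ... | q , q-path , q≤p = q , q-path , m≤n⇒m≤1+n q≤p

  to-path : ∀ {u w} (p : Walk H u w) → Σ (Walk H u w) λ q → IsPath H q × len H q ≤ len H p
  to-path here = here , All.[] ∷ [] , ≤-refl
  to-path (step {u} e p) with to-path p
  ... | q , q-path , q≤p with u ∈? verts H q
  ...   | no u∉q  = step e q , All.¬Any⇒All¬ (verts H q) u∉q ∷ q-path , s≤s q≤p
  ...   | yes u∈q with suffix-path q q-path u∈q
  ...     | r , r-path , r≤q = r , r-path , m≤n⇒m≤1+n (≤-trans r≤q q≤p)

  WalkWithin : ℕ → Fin n → Fin n → Set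
  WalkWithin k u v = Σ (Walk H u v) λ p → len H p ≤ k

  walkWithin? : ∀ k u v → Dec (WalkWithin k u v)
  walkWithin? zero u v = map′ (λ { refl → here , z≤n }) (λ { (here , _) → refl }) (u Fin.≟ v)
  walkWithin? (suc k) u v with u Fin.≟ v | Fin.any? (λ w → (adj H u w Bool.≟ true) ×-dec walkWithin? k w v)
  ... | yes refl | _                       = yes (here , z≤n)
  ... | no _     | yes (w , e , p , p≤k)   = yes (step e p , s≤s p≤k)
  ... | no u≢v   | no ∄w = no λ { (here , _) → u≢v refl ; (step e p , s≤s p≤k) → ∄w (_ , e , p , p≤k) }

  walk-by-descent : (D : Fin n → Fin n → ℕ) →
                    (∀ u v → u ≡ v ⊎ ∃ λ w → adj H u w ≡ true × suc (D w v) ≤ D u v) →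
                    ∀ u v → WalkWithin (D u v) u v
  walk-by-descent D descent u v = go (D u v) u v ≤-refl
    where
    go : ∀ k u v → D u v ≤ k → WalkWithin k u v
    go k u v D≤k with descent u v
    go k       u .u _   | inj₁ refl = here , z≤n
    go zero    u v  D≤0 | inj₂ (w , e , lt) = contradiction (≤-trans lt D≤0) λ ()
    go (suc k) u v  D≤k | inj₂ (w , e , lt) with go k w v (s≤s⁻¹ (≤-trans lt D≤k))
    ... | p , p≤k = step e p , s≤s p≤k

module Distance {n : ℕ} (H : Graph n) (connected : ∀ u v → Walk H u v) where

  open Walks H

  private
    shortest : ∀ u v → Σ ℕ λ k → WalkWithin k u v × (∀ {j} → WalkWithin j u v → k ≤ j)
    shortest u v = least-witness (λ k → walkWithin? k u v) (connected u v , ≤-refl)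

  dist : Fin n → Fin n → ℕ
  dist u v = proj₁ (shortest u v)

  geodesic : ∀ u v → WalkWithin (dist u v) u v
  geodesic u v = proj₁ (proj₂ (shortest u v))

  dist-minimal : ∀ {u v} (p : Walk H u v) → dist u v ≤ len H p
  dist-minimal p = proj₂ (proj₂ (shortest _ _)) (p , ≤-refl)

  dist-refl : ∀ u → dist u u ≡ 0
  dist-refl u = n≤0⇒n≡0 (dist-minimal here)

  dist-pos : ∀ {u v} → u ≢ v → 1 ≤ dist u v
  dist-pos {u} {v} u≢v with geodesic u v
  ... | here     , _   = contradiction refl u≢v
  ... | step e p , p≤d = ≤-trans (s≤s z≤n) p≤d

  dist-sym : ∀ u v → dist u v ≡ dist v u
  dist-sym u v = ≤-antisym (dist-reverse v u) (dist-reverse u v)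
    where
    dist-reverse : ∀ u v → dist v u ≤ dist u v
    dist-reverse u v =
      let p , p≤d = geodesic u v in
      ≤-trans (dist-minimal (reverse p)) (≤-trans (≤-reflexive (len-reverse p)) p≤d)

  dist-triangle : ∀ u v w → dist u w ≤ dist u v + dist v w
  dist-triangle u v w =
    let p , p≤d = geodesic u v
        q , q≤d = geodesic v w
    in ≤-trans (dist-minimal (p ++ʷ q)) (≤-trans (≤-reflexive (len-++ʷ p q)) (+-mono-≤ p≤d q≤d))

  ∣dist-dist∣≤dist : ∀ t u v → ∣ dist u t - dist v t ∣ ≤ dist u v
  ∣dist-dist∣≤dist t u v = m≤n+o∧n≤m+o⇒∣m-n∣≤o
    (≤-trans (dist-triangle u v t) (≤-reflexive (+-comm (dist u v) (dist v t))))
    (≤-trans (dist-triangle v u t) (≤-reflexive (trans (+-comm (dist v u) (dist u t)) (cong (dist u t +_) (dist-sym v u)))))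

  midpoint : ∀ {u v} → dist u v ≡ 2 → ∃ λ z → dist u z ≤ 1 × dist z v ≤ 1
  midpoint {u} {v} d≡2 with geodesic u v
  ... | here , _ = contradiction (trans (≡.sym (dist-refl u)) d≡2) λ ()
  ... | step e p , p≤d =
    _ , dist-minimal (step e here) , ≤-trans (dist-minimal p) (s≤s⁻¹ (subst (suc (len H p) ≤_) d≡2 p≤d))

  shortest-path-length : ∀ {u w} {p : Walk H u w} → IsShortestPath H p → len H p ≡ dist u w
  shortest-path-length {u} {w} {p} (_ , p-shortest) =
    let q , q≤d = geodesic u w
        r , r-path , r≤q = to-path q
    in ≤-antisym (≤-trans (p-shortest r r-path) (≤-trans r≤q q≤d)) (dist-minimal p)

  dist-through : ∀ {u v w} {p : Walk H u w} → IsShortestPath H p → v ∈ verts H p →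
                 dist u w ≡ dist u v + dist v w
  dist-through {u} {v} {w} {p} p-shortest v∈p with split-at p v∈p
  ... | p₁ , p₂ , len-split = ≤-antisym (dist-triangle u v w) (begin
    dist u v + dist v w  ≤⟨ +-mono-≤ (dist-minimal p₁) (dist-minimal p₂) ⟩
    len H p₁ + len H p₂  ≡⟨ len-split ⟩
    len H p              ≡⟨ shortest-path-length p-shortest ⟩
    dist u w             ∎)
    where open ℕ.≤-Reasoning

  strongly-resolves⇒dist≡∣-∣ : ∀ {t u v} → StronglyResolves H t u v → dist u v ≡ ∣ dist u t - dist v t ∣
  strongly-resolves⇒dist≡∣-∣ {t} {u} {v} (inj₁ (p , p-shortest , v∈p)) = ≡.sym (begin
    ∣ dist u t - dist v t ∣              ≡⟨ ∣-∣-comm (dist u t) (dist v t) ⟩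
    ∣ dist v t - dist u t ∣              ≡⟨ cong (∣ dist v t -_∣) (dist-through p-shortest v∈p) ⟩
    ∣ dist v t - dist u v + dist v t ∣   ≡⟨ cong (∣ dist v t -_∣) (+-comm (dist u v) (dist v t)) ⟩
    ∣ dist v t - dist v t + dist u v ∣   ≡⟨ ∣m-m+n∣≡n (dist v t) (dist u v) ⟩
    dist u v                             ∎)
    where open ≡.≡-Reasoning
  strongly-resolves⇒dist≡∣-∣ {t} {u} {v} (inj₂ (p , p-shortest , u∈p)) = ≡.sym (begin
    ∣ dist u t - dist v t ∣              ≡⟨ cong (∣ dist u t -_∣) (dist-through p-shortest u∈p) ⟩
    ∣ dist u t - dist v u + dist u t ∣   ≡⟨ cong (∣ dist u t -_∣) (+-comm (dist v u) (dist u t)) ⟩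
    ∣ dist u t - dist u t + dist v u ∣   ≡⟨ ∣m-m+n∣≡n (dist u t) (dist v u) ⟩
    dist v u                             ≡⟨ dist-sym v u ⟩
    dist u v                             ∎)
    where open ≡.≡-Reasoning

Label : Set
Label = ℕ × ℕ

chebyshev : Label → Label → ℕ
chebyshev (a , b) (c , d) = ∣ a - c ∣ ⊔ ∣ b - d ∣

module Backtracking {V L : Set} (candidates : V → List L)
                    (accept : V × L → List (V × L) → Bool)
                    (final : List (V × L) → Bool) where

  search : List V → List (V × L) → Bool
  search []       asg = final asg
  search (v ∷ vs) asg = any (λ l → accept (v , l) asg ∧ search vs ((v , l) ∷ asg)) (candidates v)

  assignment : (V → L) → List V → List (V × L)
  assignment φ = map (λ v → v , φ v)

  module _ (φ : V → L) (φ-candidate : ∀ v → φ v ∈ candidates v)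
           (φ-accepted : ∀ v us → T (accept (v , φ v) (assignment φ us)))
           (φ-final : ∀ us → (∀ v → v ∈ us) → T (final (assignment φ us))) where

    search-finds : ∀ vs us → (∀ v → v ∈ vs ⊎ v ∈ us) → T (search vs (assignment φ us))
    search-finds []       us cover = φ-final us ([ (λ ()) , (λ v∈us → v∈us) ] ∘ cover)
    search-finds (v ∷ vs) us cover =
      Any.any⁺ _ (Any.map (λ { refl → Equivalence.from Bool.T-∧ (φ-accepted v us , search-finds vs (v ∷ us) cover′) })
                          (φ-candidate v))
      where
      cover′ : ∀ w → w ∈ vs ⊎ w ∈ v ∷ us
      cover′ w with cover w
      ... | inj₁ (here w≡v)  = inj₂ (here w≡v)
      ... | inj₁ (there w∈vs) = inj₁ w∈vs
      ... | inj₂ w∈us        = inj₂ (there w∈us)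

    search-complete : ∀ order → (∀ v → v ∈ order) → T (search order [])
    search-complete order cover = search-finds order [] (inj₁ ∘ cover)

module LandmarkSearch {n : ℕ} (D : Fin n → Fin n → ℕ) (x y : Fin n) where

  Anchored : Fin n → Fin n → ℕ → Set
  Anchored t v a = (v ≡ t → a ≡ 0) × (v ≢ t → 1 ≤ a)

  anchored? : ∀ t v a → Dec (Anchored t v a)
  anchored? t v a = (v Fin.≟ t →-dec a ℕ.≟ 0) ×-dec (¬? (v Fin.≟ t) →-dec 1 ≤? a)

  Compatible : Fin n × Label → Fin n × Label → Set
  Compatible (u , p) (v , q) = u ≢ v → 1 ≤ chebyshev p q × chebyshev p q ≤ D u v

  compatible? : ∀ e e′ → Dec (Compatible e e′)
  compatible? (u , p) (v , q) = ¬? (u Fin.≟ v) →-dec (1 ≤? chebyshev p q ×-dec chebyshev p q ≤? D u v)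

  MidpointIn : List (Fin n × Label) → Label → Label → Set
  MidpointIn asg p q = Any (λ (_ , r) → chebyshev p r ≤ 1 × chebyshev r q ≤ 1) asg

  HasMidpoints : List (Fin n × Label) → Set
  HasMidpoints asg = All (λ (_ , p) → All (λ (_ , q) → chebyshev p q ≡ 2 → MidpointIn asg p q) asg) asg

  hasMidpoints? : ∀ asg → Dec (HasMidpoints asg)
  hasMidpoints? asg =
    all? (λ (_ , p) → all? (λ (_ , q) → chebyshev p q ℕ.≟ 2 →-dec
      any? (λ (_ , r) → chebyshev p r ≤? 1 ×-dec chebyshev r q ≤? 1) asg) asg) asg

  candidates : Fin n → List Label
  candidates v = cartesianProduct (upTo (suc (D v x))) (upTo (suc (D v y)))

  Acceptable : Fin n × Label → List (Fin n × Label) → Set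
  Acceptable (v , (a , b)) asg = Anchored x v a × Anchored y v b × All (Compatible (v , (a , b))) asg

  acceptable? : ∀ e asg → Dec (Acceptable e asg)
  acceptable? (v , (a , b)) asg = anchored? x v a ×-dec anchored? y v b ×-dec all? (compatible? (v , (a , b))) asg

  open Backtracking candidates (λ e asg → ⌊ acceptable? e asg ⌋) (λ asg → ⌊ hasMidpoints? asg ⌋) public

  record LandmarkEmbedding (φ : Fin n → Label) : Set where
    field
      bounded₁   : ∀ v → proj₁ (φ v) ≤ D v x
      bounded₂   : ∀ v → proj₂ (φ v) ≤ D v y
      anchored₁  : ∀ v → Anchored x v (proj₁ (φ v))
      anchored₂  : ∀ v → Anchored y v (proj₂ (φ v))
      compatible : ∀ u v → Compatible (u , φ u) (v , φ v)
      midpoint   : ∀ u v → chebyshev (φ u) (φ v) ≡ 2 →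
                   ∃ λ z → chebyshev (φ u) (φ z) ≤ 1 × chebyshev (φ z) (φ v) ≤ 1

  embedding⇒search : ∀ {φ} → LandmarkEmbedding φ → ∀ order → (∀ v → v ∈ order) → T (search order [])
  embedding⇒search {φ} emb = search-complete φ φ-candidate φ-accepted φ-final
    where
    open LandmarkEmbedding emb
    φ-candidate : ∀ v → φ v ∈ candidates v
    φ-candidate v = ∈-cartesianProduct⁺ (∈-upTo⁺ (s≤s (bounded₁ v))) (∈-upTo⁺ (s≤s (bounded₂ v)))
    φ-accepted : ∀ v us → True (acceptable? (v , φ v) (assignment φ us))
    φ-accepted v us = fromWitness (anchored₁ v , anchored₂ v , All.map⁺ (All.universal (compatible v) us))
    φ-final : ∀ us → (∀ v → v ∈ us) → True (hasMidpoints? (assignment φ us))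
    φ-final us cover = fromWitness (All.map⁺ (All.universal (λ u → All.map⁺ (All.universal (λ v eq →
      let z , uz , zv = midpoint u v eq in Any.map⁺ (Any.map (λ { refl → uz , zv }) (cover z))) us)) us))

StronglyResolvedBy : ∀ {n} → Graph n → Fin n → Fin n → Set
StronglyResolvedBy H x y = ∀ u v → u ≢ v → ∃ λ t → (t ≡ x ⊎ t ≡ y) × StronglyResolves H t u v

module TwoLandmarks {n : ℕ} (H : Graph n) (connected : ∀ u v → Walk H u v) {x y : Fin n}
                    (resolved : StronglyResolvedBy H x y) where

  open Distance H connected

  landmarks : Fin n → Label
  landmarks v = dist v x , dist v y

  dist≡chebyshev : ∀ u v → dist u v ≡ chebyshev (landmarks u) (landmarks v)
  dist≡chebyshev u v = ≤-antisym dist≤chebyshev (⊔-lub (∣dist-dist∣≤dist x u v) (∣dist-dist∣≤dist y u v))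
    where
    dist≤chebyshev : dist u v ≤ chebyshev (landmarks u) (landmarks v)
    dist≤chebyshev with u Fin.≟ v
    ... | yes refl = ≤-trans (≤-reflexive (dist-refl u)) z≤n
    ... | no u≢v with resolved u v u≢v
    ...   | _ , inj₁ refl , x-resolves = ≤-trans (≤-reflexive (strongly-resolves⇒dist≡∣-∣ x-resolves)) (m≤m⊔n _ _)
    ...   | _ , inj₂ refl , y-resolves = ≤-trans (≤-reflexive (strongly-resolves⇒dist≡∣-∣ y-resolves)) (m≤n⊔m _ _)

  landmark-embedding : (D : Fin n → Fin n → ℕ) → (∀ u v → dist u v ≤ D u v) →
                       LandmarkSearch.LandmarkEmbedding D x y landmarks
  landmark-embedding D dist≤D = record
    { bounded₁   = λ v → dist≤D v x
    ; bounded₂   = λ v → dist≤D v y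
    ; anchored₁  = λ v → (λ { refl → dist-refl x }) , dist-pos
    ; anchored₂  = λ v → (λ { refl → dist-refl y }) , dist-pos
    ; compatible = λ u v u≢v → subst (1 ≤_) (dist≡chebyshev u v) (dist-pos u≢v)
                             , subst (_≤ D u v) (dist≡chebyshev u v) (dist≤D u v)
    ; midpoint   = λ u v chebyshev≡2 →
        let z , uz , zv = midpoint (trans (dist≡chebyshev u v) chebyshev≡2)
        in z , subst (_≤ 1) (dist≡chebyshev u z) uz , subst (_≤ 1) (dist≡chebyshev z v) zv
    }

elements : ∀ {n} → Subset n → List (Fin n)
elements []            = []
elements (inside  ∷ p) = zero ∷ map suc (elements p)
elements (outside ∷ p) = map suc (elements p)

length-elements : ∀ {n} (p : Subset n) → length (elements p) ≡ ∣ p ∣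
length-elements []            = refl
length-elements (inside  ∷ p) = cong suc (trans (length-map suc (elements p)) (length-elements p))
length-elements (outside ∷ p) = trans (length-map suc (elements p)) (length-elements p)

∈ₛ⇒∈-elements : ∀ {n} {p : Subset n} {w} → w ∈ₛ p → w ∈ elements p
∈ₛ⇒∈-elements {p = inside  ∷ p} here          = here refl
∈ₛ⇒∈-elements {p = inside  ∷ p} (there w∈p) = there (∈-map⁺ suc (∈ₛ⇒∈-elements w∈p))
∈ₛ⇒∈-elements {p = outside ∷ p} (there w∈p) = ∈-map⁺ suc (∈ₛ⇒∈-elements w∈p)

covered-by-two : ∀ {n} (ws : List (Fin (suc n))) → length ws ≤ 2 →
                 ∃₂ λ x y → ∀ {w} → w ∈ ws → w ≡ x ⊎ w ≡ y
covered-by-two []           _ = zero , zero , λ ()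
covered-by-two (x ∷ [])     _ = x , x , λ { (here w≡x) → inj₁ w≡x }
covered-by-two (x ∷ y ∷ []) _ = x , y , λ { (here w≡x) → inj₁ w≡x ; (there (here w≡y)) → inj₂ w≡y }
covered-by-two (_ ∷ _ ∷ _ ∷ _) (s≤s (s≤s ()))

subset-covered-by-two : ∀ {n} (W : Subset (suc n)) → ∣ W ∣ ≤ 2 →
                        ∃₂ λ x y → ∀ {w} → w ∈ₛ W → w ≡ x ⊎ w ≡ y
subset-covered-by-two W ∣W∣≤2 =
  let x , y , cover = covered-by-two (elements W) (subst (_≤ 2) (≡.sym (length-elements W)) ∣W∣≤2)
  in x , y , cover ∘ ∈ₛ⇒∈-elements

-- The distance matrix of G, indexed w₁ = 0, a₁ = 1, …, w₂ = 22; only the upper bound it gives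
-- on distances in supergraphs, certified by distanceG-descends, is used.
distanceTableG : Vec (Vec ℕ 23) 23
distanceTableG =
  ( 0 ∷ 1 ∷ 1 ∷ 1 ∷ 2 ∷ 2 ∷ 2 ∷ 2 ∷ 3 ∷ 3 ∷ 3 ∷ 3 ∷ 3 ∷ 4 ∷ 4 ∷ 4 ∷ 5 ∷ 5 ∷ 5 ∷ 6 ∷ 6 ∷ 6 ∷ 5 ∷ [])
  ∷ (1 ∷ 0 ∷ 1 ∷ 2 ∷ 1 ∷ 1 ∷ 1 ∷ 2 ∷ 2 ∷ 2 ∷ 2 ∷ 2 ∷ 2 ∷ 3 ∷ 3 ∷ 3 ∷ 4 ∷ 4 ∷ 4 ∷ 5 ∷ 5 ∷ 5 ∷ 4 ∷ [])
  ∷ (1 ∷ 1 ∷ 0 ∷ 1 ∷ 2 ∷ 1 ∷ 1 ∷ 1 ∷ 3 ∷ 2 ∷ 2 ∷ 2 ∷ 2 ∷ 4 ∷ 3 ∷ 3 ∷ 4 ∷ 4 ∷ 4 ∷ 5 ∷ 5 ∷ 5 ∷ 5 ∷ [])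
  ∷ (1 ∷ 2 ∷ 1 ∷ 0 ∷ 3 ∷ 2 ∷ 1 ∷ 1 ∷ 4 ∷ 3 ∷ 2 ∷ 2 ∷ 2 ∷ 5 ∷ 4 ∷ 3 ∷ 5 ∷ 4 ∷ 4 ∷ 5 ∷ 5 ∷ 5 ∷ 6 ∷ [])
  ∷ (2 ∷ 1 ∷ 2 ∷ 3 ∷ 0 ∷ 1 ∷ 2 ∷ 3 ∷ 1 ∷ 1 ∷ 1 ∷ 2 ∷ 3 ∷ 2 ∷ 2 ∷ 2 ∷ 3 ∷ 3 ∷ 3 ∷ 4 ∷ 4 ∷ 4 ∷ 3 ∷ [])
  ∷ (2 ∷ 1 ∷ 1 ∷ 2 ∷ 1 ∷ 0 ∷ 1 ∷ 2 ∷ 2 ∷ 1 ∷ 1 ∷ 1 ∷ 2 ∷ 3 ∷ 2 ∷ 2 ∷ 3 ∷ 3 ∷ 3 ∷ 4 ∷ 4 ∷ 4 ∷ 4 ∷ [])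
  ∷ (2 ∷ 1 ∷ 1 ∷ 1 ∷ 2 ∷ 1 ∷ 0 ∷ 1 ∷ 3 ∷ 2 ∷ 1 ∷ 1 ∷ 1 ∷ 4 ∷ 3 ∷ 2 ∷ 4 ∷ 3 ∷ 3 ∷ 4 ∷ 4 ∷ 4 ∷ 5 ∷ [])
  ∷ (2 ∷ 2 ∷ 1 ∷ 1 ∷ 3 ∷ 2 ∷ 1 ∷ 0 ∷ 4 ∷ 3 ∷ 2 ∷ 1 ∷ 1 ∷ 5 ∷ 4 ∷ 3 ∷ 5 ∷ 4 ∷ 4 ∷ 5 ∷ 5 ∷ 5 ∷ 6 ∷ [])
  ∷ (3 ∷ 2 ∷ 3 ∷ 4 ∷ 1 ∷ 2 ∷ 3 ∷ 4 ∷ 0 ∷ 1 ∷ 2 ∷ 3 ∷ 4 ∷ 1 ∷ 1 ∷ 1 ∷ 2 ∷ 2 ∷ 2 ∷ 3 ∷ 3 ∷ 3 ∷ 2 ∷ [])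
  ∷ (3 ∷ 2 ∷ 2 ∷ 3 ∷ 1 ∷ 1 ∷ 2 ∷ 3 ∷ 1 ∷ 0 ∷ 1 ∷ 2 ∷ 3 ∷ 2 ∷ 1 ∷ 1 ∷ 2 ∷ 2 ∷ 2 ∷ 3 ∷ 3 ∷ 3 ∷ 3 ∷ [])
  ∷ (3 ∷ 2 ∷ 2 ∷ 2 ∷ 1 ∷ 1 ∷ 1 ∷ 2 ∷ 2 ∷ 1 ∷ 0 ∷ 1 ∷ 2 ∷ 3 ∷ 2 ∷ 1 ∷ 3 ∷ 2 ∷ 2 ∷ 3 ∷ 3 ∷ 3 ∷ 4 ∷ [])
  ∷ (3 ∷ 2 ∷ 2 ∷ 2 ∷ 2 ∷ 1 ∷ 1 ∷ 1 ∷ 3 ∷ 2 ∷ 1 ∷ 0 ∷ 1 ∷ 4 ∷ 3 ∷ 2 ∷ 4 ∷ 3 ∷ 3 ∷ 4 ∷ 4 ∷ 4 ∷ 5 ∷ [])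
  ∷ (3 ∷ 2 ∷ 2 ∷ 2 ∷ 3 ∷ 2 ∷ 1 ∷ 1 ∷ 4 ∷ 3 ∷ 2 ∷ 1 ∷ 0 ∷ 5 ∷ 4 ∷ 3 ∷ 5 ∷ 4 ∷ 4 ∷ 5 ∷ 5 ∷ 5 ∷ 6 ∷ [])
  ∷ (4 ∷ 3 ∷ 4 ∷ 5 ∷ 2 ∷ 3 ∷ 4 ∷ 5 ∷ 1 ∷ 2 ∷ 3 ∷ 4 ∷ 5 ∷ 0 ∷ 1 ∷ 2 ∷ 1 ∷ 1 ∷ 2 ∷ 2 ∷ 2 ∷ 2 ∷ 1 ∷ [])
  ∷ (4 ∷ 3 ∷ 3 ∷ 4 ∷ 2 ∷ 2 ∷ 3 ∷ 4 ∷ 1 ∷ 1 ∷ 2 ∷ 3 ∷ 4 ∷ 1 ∷ 0 ∷ 1 ∷ 1 ∷ 1 ∷ 1 ∷ 2 ∷ 2 ∷ 2 ∷ 2 ∷ [])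
  ∷ (4 ∷ 3 ∷ 3 ∷ 3 ∷ 2 ∷ 2 ∷ 2 ∷ 3 ∷ 1 ∷ 1 ∷ 1 ∷ 2 ∷ 3 ∷ 2 ∷ 1 ∷ 0 ∷ 2 ∷ 1 ∷ 1 ∷ 2 ∷ 2 ∷ 2 ∷ 3 ∷ [])
  ∷ (5 ∷ 4 ∷ 4 ∷ 5 ∷ 3 ∷ 3 ∷ 4 ∷ 5 ∷ 2 ∷ 2 ∷ 3 ∷ 4 ∷ 5 ∷ 1 ∷ 1 ∷ 2 ∷ 0 ∷ 1 ∷ 2 ∷ 1 ∷ 1 ∷ 2 ∷ 1 ∷ [])
  ∷ (5 ∷ 4 ∷ 4 ∷ 4 ∷ 3 ∷ 3 ∷ 3 ∷ 4 ∷ 2 ∷ 2 ∷ 2 ∷ 3 ∷ 4 ∷ 1 ∷ 1 ∷ 1 ∷ 1 ∷ 0 ∷ 1 ∷ 1 ∷ 1 ∷ 1 ∷ 2 ∷ [])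
  ∷ (5 ∷ 4 ∷ 4 ∷ 4 ∷ 3 ∷ 3 ∷ 3 ∷ 4 ∷ 2 ∷ 2 ∷ 2 ∷ 3 ∷ 4 ∷ 2 ∷ 1 ∷ 1 ∷ 2 ∷ 1 ∷ 0 ∷ 2 ∷ 1 ∷ 1 ∷ 3 ∷ [])
  ∷ (6 ∷ 5 ∷ 5 ∷ 5 ∷ 4 ∷ 4 ∷ 4 ∷ 5 ∷ 3 ∷ 3 ∷ 3 ∷ 4 ∷ 5 ∷ 2 ∷ 2 ∷ 2 ∷ 1 ∷ 1 ∷ 2 ∷ 0 ∷ 1 ∷ 2 ∷ 1 ∷ [])
  ∷ (6 ∷ 5 ∷ 5 ∷ 5 ∷ 4 ∷ 4 ∷ 4 ∷ 5 ∷ 3 ∷ 3 ∷ 3 ∷ 4 ∷ 5 ∷ 2 ∷ 2 ∷ 2 ∷ 1 ∷ 1 ∷ 1 ∷ 1 ∷ 0 ∷ 1 ∷ 2 ∷ [])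
  ∷ (6 ∷ 5 ∷ 5 ∷ 5 ∷ 4 ∷ 4 ∷ 4 ∷ 5 ∷ 3 ∷ 3 ∷ 3 ∷ 4 ∷ 5 ∷ 2 ∷ 2 ∷ 2 ∷ 2 ∷ 1 ∷ 1 ∷ 2 ∷ 1 ∷ 0 ∷ 3 ∷ [])
  ∷ (5 ∷ 4 ∷ 5 ∷ 6 ∷ 3 ∷ 4 ∷ 5 ∷ 6 ∷ 2 ∷ 3 ∷ 4 ∷ 5 ∷ 6 ∷ 1 ∷ 2 ∷ 3 ∷ 1 ∷ 2 ∷ 3 ∷ 1 ∷ 2 ∷ 3 ∷ 0 ∷ [])
  ∷ []

distanceG : Fin 23 → Fin 23 → ℕ
distanceG u v = lookup (lookup distanceTableG u) v

StepTowards : Fin 23 → Fin 23 → Fin 23 × Fin 23 → Set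
StepTowards u v (a , b) = (a ≡ u × suc (distanceG b v) ≤ distanceG u v) ⊎ (b ≡ u × suc (distanceG a v) ≤ distanceG u v)

-- Kept opaque: unfolding the certificate of the decision procedure in later conversion checks
-- exhausts memory.
opaque
  distanceG-descends : ∀ u v → u ≡ v ⊎ Any (StepTowards u v) edgesG
  distanceG-descends = toWitness {a? = Fin.all? λ u → Fin.all? λ v → u Fin.≟ v ⊎-dec any? (stepTowards? u v) edgesG} _
    where
    stepTowards? : ∀ u v e → Dec (StepTowards u v e)
    stepTowards? u v (a , b) = (a Fin.≟ u ×-dec suc (distanceG b v) ≤? distanceG u v)
                         ⊎-dec (b Fin.≟ u ×-dec suc (distanceG a v) ≤? distanceG u v)

-- Labelling in breadth-first order from x makes the search fail early.
byDistance : Fin 23 → List (Fin 23)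
byDistance x = concatMap (λ k → filter (λ v → distanceG v x ℕ.≟ k) (allFin 23)) (upTo 7)

byDistance-complete : ∀ x v → v ∈ byDistance x
byDistance-complete = toWitness {a? = Fin.all? λ x → Fin.all? λ v → v ∈? byDistance x} _
  where open import Data.List.Membership.DecPropositional (Fin._≟_ {23}) using (_∈?_)

search-fails : ∀ x y → T (not (LandmarkSearch.search distanceG x y (byDistance x) []))
search-fails = toWitness {a? = Fin.all? λ x → Fin.all? λ y → T? (not (LandmarkSearch.search distanceG x y (byDistance x) []))} _

no-landmark-embedding : ∀ x y φ → ¬ LandmarkSearch.LandmarkEmbedding distanceG x y φ
no-landmark-embedding x y φ embedding =
  subst T (Equivalence.to Bool.T-not-≡ (search-fails x y))
    (LandmarkSearch.embedding⇒search distanceG x y embedding (byDistance x) (byDistance-complete x))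

module _ (H : Graph 23) (H⊇G : ContainsG H) where

  open Walks H

  walk-within-distanceG : ∀ u v → WalkWithin (distanceG u v) u v
  walk-within-distanceG = walk-by-descent distanceG λ u v → map₂ (step-in-H ∘ find) (distanceG-descends u v)
    where
    step-in-H : ∀ {u v} → ∃ (λ e → e ∈ edgesG × StepTowards u v e) → ∃ λ w → adj H u w ≡ true × suc (distanceG w v) ≤ distanceG u v
    step-in-H ((_ , b) , ab∈G , inj₁ (refl , lt)) = b , H⊇G _ _ ab∈G , lt
    step-in-H ((a , _) , ab∈G , inj₂ (refl , lt)) = a , trans (Graph.sym H _ _) (H⊇G _ _ ab∈G) , lt

  connected : ∀ u v → Walk H u v
  connected u v = proj₁ (walk-within-distanceG u v)

  open Distance H connected using (dist; dist-minimal)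

  dist≤distanceG : ∀ u v → dist u v ≤ distanceG u v
  dist≤distanceG u v = let p , p≤D = walk-within-distanceG u v in ≤-trans (dist-minimal p) p≤D

  no-two-landmarks : ∀ x y → ¬ StronglyResolvedBy H x y
  no-two-landmarks x y resolved = no-landmark-embedding x y landmarks (landmark-embedding distanceG dist≤distanceG)
    where open TwoLandmarks H connected resolved

theorem3p7 : (H : Graph 23) → ContainsG H → (W : Subset 23) → IsStrongResolvingSet H W → 2 < ∣ W ∣
theorem3p7 H H⊇G W resolving with 2 <? ∣ W ∣
... | yes 2<∣W∣ = 2<∣W∣
... | no  2≮∣W∣ =
  let x , y , W⊆xy = subset-covered-by-two W (≮⇒≥ 2≮∣W∣)
      resolved-by-xy u v u≢v = let t , t∈W , t-resolves = resolving u v u≢v in t , W⊆xy t∈W , t-resolves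
  in ⊥-elim (no-two-landmarks H H⊇G x y resolved-by-xy)
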